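{- The theories $\mathrm{STT}^{\downarrow}$ and $\mathrm{FJT}$ are definitionally equivalent.
   Context: $\mathrm{FJT}$: types $n<\omega$; $b^n(a^m)$ well-formed iff $m<n$; identity only between same-type terms (usual identity rules); classical logic with quantifier rules that instantiate/generalise only at the same type (from $\forall x^n\phi(x^n)$ infer $\phi(a^n)$; from $\phi(b^n)$, with $b^n$ not in undischarged assumptions, infer $\forall x^n\phi(x^n)$); FJT-Comprehension: for each $n>0$, $\exists z^n\bigwedge_{i<n}\forall x^i(z^n(x^i)\leftrightarrow\phi_i(x^i))$, whenever each $\phi_i(x^i)$ is well-formed and does not contain $z^n$. $\mathrm{STT}$: types $n<\omega$; $b^n(a^m)$ well-formed iff $n=m+1$; identity only between same-type terms; same-type quantifier rules; Comprehension $\exists z^{n+1}\forall x^n(z^{n+1}(x^n)\leftrightarrow\phi(x^n))$; identity scheme $x^n=y^n\leftrightarrow\forall z^{n+1}(z^{n+1}(x^n)\leftrightarrow z^{n+1}(y^n))$. $\mathrm{STT}^{\downarrow}$ augments $\mathrm{STT}$ with, for each $n>0$, a binary relation symbol $\rightsquigarrow$ relating a type-$(n+1)$ term to a type-$n$ term. Abbreviations: $a^n\simeq b^n:\Leftrightarrow\forall x^{n-1}(a^n(x^{n-1})\leftrightarrow b^n(x^{n-1}))$ for $n>0$; $a^n\approx b^n:\Leftrightarrow\forall x^{n-1}(a^n\rightsquigarrow x^{n-1}\leftrightarrow b^n\rightsquigarrow x^{n-1})$ for $n>1$, and $a^1\approx b^1$ always true. Axioms of $\mathrm{STT}^\downarrow$: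 $\exists z^1\forall x^0(z^1(x^0)\leftrightarrow\phi(x^0))$; for each $n\ge1$, $\forall y^n\exists z^{n+1}(z^{n+1}\rightsquigarrow y^n\wedge\forall x^n(z^{n+1}(x^n)\leftrightarrow\phi(x^n)))$ for $\phi$ not containing $z^{n+1}$; and for each $n>0$: Down$_\exists$ $\forall z^{n+1}\exists x^n\,z^{n+1}\rightsquigarrow x^n$; Down$_{\mathrm{Sim}}$ $\forall z^{n+1}\forall x^n\forall y^n((z^{n+1}\rightsquigarrow x^n\wedge z^{n+1}\rightsquigarrow y^n)\to(x^n\simeq y^n\wedge y^n\approx x^n))$; Down$_{\mathrm{Max}}$ $\forall z^{n+1}\forall x^n\forall y^n((z^{n+1}\rightsquigarrow x^n\wedge x^n\simeq y^n\wedge y^n\approx x^n)\to z^{n+1}\rightsquigarrow y^n)$. Two theories are definitionally equivalent iff there are interpretations (type-respecting translations preserving logical vocabulary and taking theorems to theorems) $I$ from the first to the second and $J$ from the second to the first such that each theory proves every atomic formula of its language equivalent to its translation under the composite of the two interpretations. -}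

module Defs where

open import Data.Nat using (ℕ; zero; suc; _<_)
open import Data.Fin using (Fin; toℕ) renaming (zero to fzero; suc to fsuc)
open import Data.Fin.Properties using (toℕ<n)
open import Data.List using (List; []; _∷_; _++_; map)
open import Data.List.Relation.Unary.All using (All; []; _∷_) renaming (map to mapAll)
open import Data.List.Membership.Propositional using (_∈_)
open import Data.Product using (Σ; _×_)

-- Terms are variables only (the paper's a^n, b^n, x^n are all variables /
-- parameters).

infix 4 _∋_
data _∋_ : List ℕ → ℕ → Set where
  here  : ∀ {Γ n} → (n ∷ Γ) ∋ n
  there : ∀ {Γ n m} → Γ ∋ n → (m ∷ Γ) ∋ n

record Sig : Set₁ where
  field
    Rel   : Set
    arity : Rel → List ℕ
open Sig public

-- Formulas. Identity (between same-type variables) is logical vocabulary.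
-- Primitive connectives: ⊥, ⇒, ∧, ∀ (the others are classical abbreviations).
infixr 5 _⇒_
infixr 6 _∧_
infix 7 _≐_
data Formula (S : Sig) (Γ : List ℕ) : Set where
  rel : (r : Rel S) → All (Γ ∋_) (arity S r) → Formula S Γ
  _≐_ : ∀ {n} → Γ ∋ n → Γ ∋ n → Formula S Γ
  ⊥'  : Formula S Γ
  _⇒_ : Formula S Γ → Formula S Γ → Formula S Γ
  _∧_ : Formula S Γ → Formula S Γ → Formula S Γ
  ∀'  : (n : ℕ) → Formula S (n ∷ Γ) → Formula S Γ

module _ {S : Sig} where
  ¬' : ∀ {Γ} → Formula S Γ → Formula S Γ
  ¬' φ = φ ⇒ ⊥'

  ⊤' : ∀ {Γ} → Formula S Γ
  ⊤' = ⊥' ⇒ ⊥'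

  ∃' : ∀ {Γ} (n : ℕ) → Formula S (n ∷ Γ) → Formula S Γ
  ∃' n φ = ¬' (∀' n (¬' φ))

  infix 4 _⇔_
  _⇔_ : ∀ {Γ} → Formula S Γ → Formula S Γ → Formula S Γ
  φ ⇔ ψ = (φ ⇒ ψ) ∧ (ψ ⇒ φ)

Ren : List ℕ → List ℕ → Set
Ren Γ Δ = ∀ {n} → Γ ∋ n → Δ ∋ n

ext : ∀ {Γ Δ m} → Ren Γ Δ → Ren (m ∷ Γ) (m ∷ Δ)
ext ρ here      = here
ext ρ (there v) = there (ρ v)

rename : ∀ {S Γ Δ} → Ren Γ Δ → Formula S Γ → Formula S Δ
rename ρ (rel r args) = rel r (mapAll ρ args)
rename ρ (x ≐ y)      = ρ x ≐ ρ y
rename ρ ⊥'           = ⊥'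
rename ρ (φ ⇒ ψ)      = rename ρ φ ⇒ rename ρ ψ
rename ρ (φ ∧ ψ)      = rename ρ φ ∧ rename ρ ψ
rename ρ (∀' n φ)     = ∀' n (rename (ext ρ) φ)

wk : ∀ {S Γ m} → Formula S Γ → Formula S (m ∷ Γ)
wk = rename there

-- weakening under one binder (the formula does not mention the new
-- variable, which sits just below the bound one)
wk₁ : ∀ {S Γ n m} → Formula S (n ∷ Γ) → Formula S (n ∷ m ∷ Γ)
wk₁ = rename (ext there)

sub₁ : ∀ {Γ n} → Γ ∋ n → Ren (n ∷ Γ) Γ
sub₁ x here      = x
sub₁ x (there v) = v

_[_] : ∀ {S Γ n} → Formula S (n ∷ Γ) → Γ ∋ n → Formula S Γ
φ [ x ] = rename (sub₁ x) φ

wkᴾ : ∀ {Γ} (Ψ : List ℕ) → Ren Γ (Ψ ++ Γ)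
wkᴾ []      v = v
wkᴾ (m ∷ Ψ) v = there (wkᴾ Ψ v)

-- Theories: axiom schemes, given as open formulas in any context
-- (free variables = parameters).

Theory : Sig → Set₁
Theory S = (Γ : List ℕ) → Formula S Γ → Set

data Der {S : Sig} (T : Theory S) : (Γ : List ℕ) → List (Formula S Γ) → Formula S Γ → Set where
  ax   : ∀ {Γ Δ φ} → T Γ φ → Der T Γ Δ φ
  hyp  : ∀ {Γ Δ φ} → φ ∈ Δ → Der T Γ Δ φ
  ⇒I   : ∀ {Γ Δ φ ψ} → Der T Γ (φ ∷ Δ) ψ → Der T Γ Δ (φ ⇒ ψ)
  ⇒E   : ∀ {Γ Δ φ ψ} → Der T Γ Δ (φ ⇒ ψ) → Der T Γ Δ φ → Der T Γ Δ ψ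
  ∧I   : ∀ {Γ Δ φ ψ} → Der T Γ Δ φ → Der T Γ Δ ψ → Der T Γ Δ (φ ∧ ψ)
  ∧E₁  : ∀ {Γ Δ φ ψ} → Der T Γ Δ (φ ∧ ψ) → Der T Γ Δ φ
  ∧E₂  : ∀ {Γ Δ φ ψ} → Der T Γ Δ (φ ∧ ψ) → Der T Γ Δ ψ
  -- generalisation: the eigenvariable is fresh (not in Δ)
  ∀I   : ∀ {Γ Δ n φ} → Der T (n ∷ Γ) (map wk Δ) φ → Der T Γ Δ (∀' n φ)
  ∀E   : ∀ {Γ Δ n φ} → Der T Γ Δ (∀' n φ) → (x : Γ ∋ n) → Der T Γ Δ (φ [ x ])
  raa  : ∀ {Γ Δ φ} → Der T Γ (¬' φ ∷ Δ) ⊥' → Der T Γ Δ φ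
  ≐refl  : ∀ {Γ Δ n} (x : Γ ∋ n) → Der T Γ Δ (x ≐ x)
  ≐subst : ∀ {Γ Δ n} {x y : Γ ∋ n} (φ : Formula S (n ∷ Γ)) →
           Der T Γ Δ (x ≐ y) → Der T Γ Δ (φ [ x ]) → Der T Γ Δ (φ [ y ])

-- T proves φ (φ with free variables Γ): derivable without assumptions,
-- possibly using further parameters (constants of each type are always
-- available, as in the paper's syntax).
Provable : ∀ {S} → Theory S → (Γ : List ℕ) → Formula S Γ → Set
Provable T Γ φ = Σ (List ℕ) λ Ψ → Der T (Ψ ++ Γ) [] (rename (wkᴾ Ψ) φ)

lookupArg : ∀ {Γ Δ n} → All (Γ ∋_) Δ → Δ ∋ n → Γ ∋ n
lookupArg (a ∷ as) here      = a
lookupArg (a ∷ as) (there v) = lookupArg as v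

-- Translation induced by assigning to each relation symbol r of S₁ a
-- formula of S₂ whose free variables are the arguments of r (same types):
-- type-respecting, preserving logical vocabulary (incl. identity).
Transl : Sig → Sig → Set
Transl S₁ S₂ = (r : Rel S₁) → Formula S₂ (arity S₁ r)

translate : ∀ {S₁ S₂ Γ} → Transl S₁ S₂ → Formula S₁ Γ → Formula S₂ Γ
translate τ (rel r args) = rename (lookupArg args) (τ r)
translate τ (x ≐ y)      = x ≐ y
translate τ ⊥'           = ⊥'
translate τ (φ ⇒ ψ)      = translate τ φ ⇒ translate τ ψ
translate τ (φ ∧ ψ)      = translate τ φ ∧ translate τ ψ
translate τ (∀' n φ)     = ∀' n (translate τ φ)

record Interpretation {S₁ S₂ : Sig} (T₁ : Theory S₁) (T₂ : Theory S₂) : Set where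
  field
    τ     : Transl S₁ S₂
    sound : ∀ Γ φ → Provable T₁ Γ φ → Provable T₂ Γ (translate τ φ)
open Interpretation public

AtomsFixed : ∀ {S} → Theory S → Transl S S → Set
AtomsFixed {S} T τ =
  (∀ Γ (r : Rel S) (args : All (Γ ∋_) (arity S r)) →
     Provable T Γ (rel r args ⇔ translate τ (rel r args)))
  × (∀ Γ n (x y : Γ ∋ n) → Provable T Γ ((x ≐ y) ⇔ translate τ (x ≐ y)))

compose : ∀ {S₁ S₂ S₃} → Transl S₁ S₂ → Transl S₂ S₃ → Transl S₁ S₃
compose I J r = translate J (I r)

DefinitionallyEquivalent : ∀ {S₁ S₂} → Theory S₁ → Theory S₂ → Set
DefinitionallyEquivalent T₁ T₂ =
  Σ (Interpretation T₁ T₂) λ I → Σ (Interpretation T₂ T₁) λ J →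
    AtomsFixed T₁ (compose (τ I) (τ J)) × AtomsFixed T₂ (compose (τ J) (τ I))

data FJRel : Set where
  -- app n m _ : the atomic formula b^n(a^m), well-formed iff m < n
  app : (n m : ℕ) → m < n → FJRel

FJSig : Sig
FJSig = record { Rel = FJRel ; arity = λ { (app n m _) → n ∷ m ∷ [] } }

⋀ : ∀ {S Γ} (k : ℕ) → (Fin (suc k) → Formula S Γ) → Formula S Γ
⋀ zero    f = f fzero
⋀ (suc k) f = f fzero ∧ ⋀ k (λ i → f (fsuc i))

-- FJT-Comprehension, for each n = suc k > 0:
--   ∃z^n ⋀_{i<n} ∀x^i (z^n(x^i) ↔ φ_i(x^i)),  φ_i not containing z^n.
data FJT : Theory FJSig where
  comp : ∀ {Γ} (k : ℕ) (φ : (i : Fin (suc k)) → Formula FJSig (toℕ i ∷ Γ)) →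
    FJT Γ (∃' (suc k) (⋀ k (λ i →
      ∀' (toℕ i)
        (rel (app (suc k) (toℕ i) (toℕ<n i)) (there here ∷ here ∷ [])
          ⇔ wk₁ (φ i)))))

data SRel : Set where
  -- app n : b^{n+1}(a^n)
  app  : (n : ℕ) → SRel
  -- down k : z^{k+2} ⇝ y^{k+1}   (the relation ⇝ for type n = k+1 > 0)
  down : (k : ℕ) → SRel

SSig : Sig
SSig = record { Rel = SRel ; arity = λ { (app n) → suc n ∷ n ∷ [] ; (down k) → suc (suc k) ∷ suc k ∷ [] } }

-- a^{k+1} ≃ b^{k+1} :⇔ ∀x^k (a(x) ↔ b(x))
sim : ∀ {Γ} (k : ℕ) → Γ ∋ suc k → Γ ∋ suc k → Formula SSig Γ
sim k a b = ∀' k (rel (app k) (there a ∷ here ∷ []) ⇔ rel (app k) (there b ∷ here ∷ []))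

-- a^{k+1} ≈ b^{k+1} :⇔ ∀x^k (a ⇝ x ↔ b ⇝ x) if k+1 > 1; always true if k+1 = 1
approx : ∀ {Γ} (k : ℕ) → Γ ∋ suc k → Γ ∋ suc k → Formula SSig Γ
approx zero    a b = ⊤'
approx (suc j) a b = ∀' (suc j) (rel (down j) (there a ∷ here ∷ []) ⇔ rel (down j) (there b ∷ here ∷ []))

data STTdown : Theory SSig where
  -- STT Comprehension (STT↓ augments STT):  ∃z^{n+1} ∀x^n (z(x) ↔ φ(x))
  compSTT : ∀ {Γ} (n : ℕ) (φ : Formula SSig (n ∷ Γ)) →
    STTdown Γ (∃' (suc n) (∀' n (rel (app n) (there here ∷ here ∷ []) ⇔ wk₁ φ)))
  -- STT identity scheme:  x^n = y^n ↔ ∀z^{n+1} (z(x) ↔ z(y))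
  ident : ∀ {Γ} (n : ℕ) →
    STTdown Γ (∀' n (∀' n ((there here ≐ here) ⇔
      ∀' (suc n) (rel (app n) (here ∷ there (there here) ∷ []) ⇔ rel (app n) (here ∷ there here ∷ [])))))
  -- ∃z^1 ∀x^0 (z(x) ↔ φ(x))
  comp₀ : ∀ {Γ} (φ : Formula SSig (0 ∷ Γ)) →
    STTdown Γ (∃' 1 (∀' 0 (rel (app 0) (there here ∷ here ∷ []) ⇔ wk₁ φ)))
  -- for n = k+1 ≥ 1:  ∀y^n ∃z^{n+1} (z ⇝ y ∧ ∀x^n (z(x) ↔ φ(x))),  φ not containing z
  --   (φ may contain y and other parameters)
  compDown : ∀ {Γ} (k : ℕ) (φ : Formula SSig (suc k ∷ suc k ∷ Γ)) →
    STTdown Γ (∀' (suc k) (∃' (suc (suc k))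
      (rel (down k) (here ∷ there here ∷ [])
       ∧ ∀' (suc k) (rel (app (suc k)) (there here ∷ here ∷ []) ⇔ wk₁ φ))))
  -- Down_∃ : ∀z^{n+1} ∃x^n z ⇝ x
  downEx : ∀ {Γ} (k : ℕ) →
    STTdown Γ (∀' (suc (suc k)) (∃' (suc k) (rel (down k) (there here ∷ here ∷ []))))
  -- Down_Sim : ∀z ∀x ∀y ((z ⇝ x ∧ z ⇝ y) → (x ≃ y ∧ y ≈ x))
  downSim : ∀ {Γ} (k : ℕ) →
    STTdown Γ (∀' (suc (suc k)) (∀' (suc k) (∀' (suc k)
      ((rel (down k) (there (there here) ∷ there here ∷ [])
        ∧ rel (down k) (there (there here) ∷ here ∷ []))
       ⇒ (sim k (there here) here ∧ approx k here (there here))))))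
  -- Down_Max : ∀z ∀x ∀y ((z ⇝ x ∧ x ≃ y ∧ y ≈ x) → z ⇝ y)
  downMax : ∀ {Γ} (k : ℕ) →
    STTdown Γ (∀' (suc (suc k)) (∀' (suc k) (∀' (suc k)
      ((rel (down k) (there (there here) ∷ there here ∷ [])
        ∧ sim k (there here) here ∧ approx k here (there here))
       ⇒ rel (down k) (there (there here) ∷ here ∷ [])))))

{-# OPTIONS --safe #-}
module Submission where

open import Defs
open import Data.Nat using (ℕ; zero; suc; _<_; _≤′_; ≤′-reflexive; ≤′-refl; ≤′-step; s≤s)
open import Data.Nat.Properties using (≤-irrelevant; ≡-irrelevant; <-irrefl; ≤⇒≤′; ≤′⇒≤)
open import Data.Fin using (Fin; toℕ; fromℕ<) renaming (zero to fzero; suc to fsuc)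
open import Data.Fin.Properties using (toℕ<n; toℕ-fromℕ<)
open import Data.List using (List; []; _∷_; map)
open import Data.List.Relation.Unary.All using (All; []; _∷_) renaming (map to mapAll)
open import Data.List.Relation.Unary.Any as Any using ()
open import Data.List.Membership.Propositional.Properties using (∈-map⁺)
open import Data.List.Relation.Binary.Subset.Propositional using (_⊆_)
open import Data.List.Relation.Binary.Subset.Propositional.Properties using (map⁺; xs⊆x∷xs; ∷⁺ʳ)
open import Data.Product using (_,_)
open import Relation.Nullary using (contradiction)
open import Relation.Binary.PropositionalEquality using (_≡_; refl; sym; trans; cong; cong₂; subst; module ≡-Reasoning)

-- FJT is interpreted in STT↓ by reading the application b(a) of an object of type k+1 to one of type
-- m ≤ k as a descent b ⇝ c ⇝ … ⇝ d to an object d of type m+1 with d(a) (app↓); STT↓ is interpreted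
-- in FJT by keeping the applications between adjacent types and reading z ⇝ y as "z and y have the
-- same members at every type ≤ k" (restricts).
--
-- In STT↓, Down_Sim makes a descent independent of the ⇝-steps chosen, so descents behave like FJT
-- membership, and each instance of FJT-comprehension is built type by type from ⇝-comprehension.
-- Conversely, FJT-comprehension fixes the members of an object at all lower types at once, which
-- yields the STT↓ axioms. For the round trips: in FJT a descent keeps the members, since restrictions
-- do; in STT↓, z ⇝ y follows from "z's descents agree with y's" by Down_Max applied to some y′ with
-- z ⇝ y′ (Down_∃), where y′ ≃ y and y ≈ y′ are proved by induction on the type (sameExt⇒≃≈).

-- Renaming and translation of formulas

ext-fuse : ∀ {Γ Δ Θ m} {ρ : Ren Γ Δ} {σ : Ren Δ Θ} {τ : Ren Γ Θ} → (∀ {n} (v : Γ ∋ n) → σ (ρ v) ≡ τ v) →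
           ∀ {n} (v : (m ∷ Γ) ∋ n) → ext σ (ext ρ v) ≡ ext τ v
ext-fuse e here = refl
ext-fuse e (there v) = cong there (e v)

module _ {S : Sig} where
  mapAll-cong : ∀ {Γ Δ xs} {ρ σ : Ren Γ Δ} → (∀ {n} (v : Γ ∋ n) → ρ v ≡ σ v) →
                (as : All (Γ ∋_) xs) → mapAll ρ as ≡ mapAll σ as
  mapAll-cong e [] = refl
  mapAll-cong e (a ∷ as) = cong₂ _∷_ (e a) (mapAll-cong e as)

  mapAll-∘ : ∀ {Γ Δ Θ xs} (ρ : Ren Γ Δ) (σ : Ren Δ Θ) (as : All (Γ ∋_) xs) →
             mapAll σ (mapAll ρ as) ≡ mapAll (λ v → σ (ρ v)) as
  mapAll-∘ ρ σ [] = refl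
  mapAll-∘ ρ σ (a ∷ as) = cong (σ (ρ a) ∷_) (mapAll-∘ ρ σ as)

  mapAll-id : ∀ {Γ xs} (as : All (Γ ∋_) xs) → mapAll (λ v → v) as ≡ as
  mapAll-id [] = refl
  mapAll-id (a ∷ as) = cong (a ∷_) (mapAll-id as)

  rename-cong : ∀ {Γ Δ} {ρ σ : Ren Γ Δ} → (∀ {n} (v : Γ ∋ n) → ρ v ≡ σ v) →
                (φ : Formula S Γ) → rename ρ φ ≡ rename σ φ
  rename-cong e (rel r as) = cong (rel r) (mapAll-cong e as)
  rename-cong e (x ≐ y) = cong₂ _≐_ (e x) (e y)
  rename-cong e ⊥' = refl
  rename-cong e (φ ⇒ ψ) = cong₂ _⇒_ (rename-cong e φ) (rename-cong e ψ)
  rename-cong e (φ ∧ ψ) = cong₂ _∧_ (rename-cong e φ) (rename-cong e ψ)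
  rename-cong {ρ = ρ} {σ} e (∀' n φ) = cong (∀' n) (rename-cong ext-cong φ)
    where ext-cong : ∀ {m} (v : (n ∷ _) ∋ m) → ext ρ v ≡ ext σ v
          ext-cong here = refl
          ext-cong (there v) = cong there (e v)

  rename-∘ : ∀ {Γ Δ Θ} (ρ : Ren Γ Δ) (σ : Ren Δ Θ) (φ : Formula S Γ) →
             rename σ (rename ρ φ) ≡ rename (λ v → σ (ρ v)) φ
  rename-∘ ρ σ (rel r as) = cong (rel r) (mapAll-∘ ρ σ as)
  rename-∘ ρ σ (x ≐ y) = refl
  rename-∘ ρ σ ⊥' = refl
  rename-∘ ρ σ (φ ⇒ ψ) = cong₂ _⇒_ (rename-∘ ρ σ φ) (rename-∘ ρ σ ψ)
  rename-∘ ρ σ (φ ∧ ψ) = cong₂ _∧_ (rename-∘ ρ σ φ) (rename-∘ ρ σ ψ)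
  rename-∘ ρ σ (∀' n φ) = cong (∀' n) (trans (rename-∘ (ext ρ) (ext σ) φ) (rename-cong (ext-fuse (λ _ → refl)) φ))

  rename-id : ∀ {Γ} (φ : Formula S Γ) → rename (λ v → v) φ ≡ φ
  rename-id (rel r as) = cong (rel r) (mapAll-id as)
  rename-id (x ≐ y) = refl
  rename-id ⊥' = refl
  rename-id (φ ⇒ ψ) = cong₂ _⇒_ (rename-id φ) (rename-id ψ)
  rename-id (φ ∧ ψ) = cong₂ _∧_ (rename-id φ) (rename-id ψ)
  rename-id (∀' n φ) = cong (∀' n) (trans (rename-cong ext-id φ) (rename-id φ))
    where ext-id : ∀ {m} (v : (n ∷ _) ∋ m) → ext (λ w → w) v ≡ v
          ext-id here = refl
          ext-id (there v) = refl

  rename-fuse : ∀ {Γ Δ Θ} {ρ : Ren Γ Δ} {σ : Ren Δ Θ} {τ : Ren Γ Θ} →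
                (∀ {n} (v : Γ ∋ n) → σ (ρ v) ≡ τ v) → (φ : Formula S Γ) →
                rename σ (rename ρ φ) ≡ rename τ φ
  rename-fuse {ρ = ρ} {σ} e φ = trans (rename-∘ ρ σ φ) (rename-cong e φ)

  rename-square : ∀ {Γ Δ Δ' Θ} {ρ : Ren Γ Δ} {σ : Ren Δ Θ} {ρ' : Ren Γ Δ'} {σ' : Ren Δ' Θ} →
                  (∀ {n} (v : Γ ∋ n) → σ (ρ v) ≡ σ' (ρ' v)) → (φ : Formula S Γ) →
                  rename σ (rename ρ φ) ≡ rename σ' (rename ρ' φ)
  rename-square {ρ' = ρ'} {σ'} e φ = trans (rename-fuse e φ) (sym (rename-∘ ρ' σ' φ))

  rename-ext-wk : ∀ {Γ Δ m} (ρ : Ren Γ Δ) (φ : Formula S Γ) →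
                  rename (ext {m = m} ρ) (wk φ) ≡ wk (rename ρ φ)
  rename-ext-wk ρ φ = rename-square (λ v → refl) φ

  rename-ext²-wk₁ : ∀ {Γ Δ n m} (ρ : Ren Γ Δ) (φ : Formula S (n ∷ Γ)) →
                    rename (ext (ext {m = m} ρ)) (wk₁ φ) ≡ wk₁ (rename (ext ρ) φ)
  rename-ext²-wk₁ ρ φ = rename-square square φ
    where square : ∀ {k} (v : _ ∋ k) → ext (ext ρ) (ext there v) ≡ ext there (ext ρ v)
          square here = refl
          square (there v) = refl

  rename-[] : ∀ {Γ Δ n} (ρ : Ren Γ Δ) (φ : Formula S (n ∷ Γ)) (x : Γ ∋ n) →
              rename ρ (φ [ x ]) ≡ (rename (ext ρ) φ) [ ρ x ]
  rename-[] ρ φ x = rename-square square φ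
    where square : ∀ {m} (v : _ ∋ m) → ρ (sub₁ x v) ≡ sub₁ (ρ x) (ext ρ v)
          square here = refl
          square (there v) = refl

  wk-[here] : ∀ {Γ n} (φ : Formula S (n ∷ Γ)) → (rename (ext there) φ) [ here ] ≡ φ
  wk-[here] φ = trans (rename-fuse cancel φ) (rename-id φ)
    where cancel : ∀ {m} (v : _ ∋ m) → sub₁ here (ext there v) ≡ v
          cancel here = refl
          cancel (there v) = refl

  rename-⋀ : ∀ {Γ Δ} (ρ : Ren Γ Δ) (k : ℕ) (f : Fin (suc k) → Formula S Γ) →
             rename ρ (⋀ k f) ≡ ⋀ k (λ i → rename ρ (f i))
  rename-⋀ ρ zero f = refl
  rename-⋀ ρ (suc k) f = cong (rename ρ (f fzero) ∧_) (rename-⋀ ρ k (λ i → f (fsuc i)))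

  ⋀-cong : ∀ {Γ} (k : ℕ) {f g : Fin (suc k) → Formula S Γ} → (∀ i → f i ≡ g i) → ⋀ k f ≡ ⋀ k g
  ⋀-cong zero e = e fzero
  ⋀-cong (suc k) e = cong₂ _∧_ (e fzero) (⋀-cong k (λ i → e (fsuc i)))

module _ {S₁ S₂ : Sig} (τ : Transl S₁ S₂) where
  lookupArg-mapAll : ∀ {Γ Δ xs n} (ρ : Ren Γ Δ) (as : All (Γ ∋_) xs) (v : xs ∋ n) →
                     lookupArg (mapAll ρ as) v ≡ ρ (lookupArg as v)
  lookupArg-mapAll ρ (a ∷ as) here = refl
  lookupArg-mapAll ρ (a ∷ as) (there v) = lookupArg-mapAll ρ as v

  translate-rename : ∀ {Γ Δ} (ρ : Ren Γ Δ) (φ : Formula S₁ Γ) →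
                     translate τ (rename ρ φ) ≡ rename ρ (translate τ φ)
  translate-rename ρ (rel r as) =
    trans (rename-cong (lookupArg-mapAll ρ as) (τ r)) (sym (rename-∘ (lookupArg as) ρ (τ r)))
  translate-rename ρ (x ≐ y) = refl
  translate-rename ρ ⊥' = refl
  translate-rename ρ (φ ⇒ ψ) = cong₂ _⇒_ (translate-rename ρ φ) (translate-rename ρ ψ)
  translate-rename ρ (φ ∧ ψ) = cong₂ _∧_ (translate-rename ρ φ) (translate-rename ρ ψ)
  translate-rename ρ (∀' n φ) = cong (∀' n) (translate-rename (ext ρ) φ)

  map-translate-wk : ∀ {Γ m} (Δ : List (Formula S₁ Γ)) →
                     map (translate τ) (map (wk {m = m}) Δ) ≡ map wk (map (translate τ) Δ)
  map-translate-wk [] = refl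
  map-translate-wk (φ ∷ Δ) = cong₂ _∷_ (translate-rename there φ) (map-translate-wk Δ)

  translate-⋀ : ∀ {Γ} (k : ℕ) (f : Fin (suc k) → Formula S₁ Γ) →
                translate τ (⋀ k f) ≡ ⋀ k (λ i → translate τ (f i))
  translate-⋀ zero f = refl
  translate-⋀ (suc k) f = cong (translate τ (f fzero) ∧_) (translate-⋀ k (λ i → f (fsuc i)))

-- Derivations

record RenameClosed {S : Sig} (T : Theory S) : Set where
  field
    rename-axiom : ∀ {Γ Γ'} (ρ : Ren Γ Γ') {φ} → T Γ φ → T Γ' (rename ρ φ)
open RenameClosed {{...}}

module _ {S : Sig} {T : Theory S} where
  weakenHyps : ∀ {Γ Δ Δ' φ} → Der T Γ Δ φ → Δ ⊆ Δ' → Der T Γ Δ' φ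
  weakenHyps (ax t) s = ax t
  weakenHyps (hyp m) s = hyp (s m)
  weakenHyps (⇒I d) s = ⇒I (weakenHyps d (∷⁺ʳ _ s))
  weakenHyps (⇒E d e) s = ⇒E (weakenHyps d s) (weakenHyps e s)
  weakenHyps (∧I d e) s = ∧I (weakenHyps d s) (weakenHyps e s)
  weakenHyps (∧E₁ d) s = ∧E₁ (weakenHyps d s)
  weakenHyps (∧E₂ d) s = ∧E₂ (weakenHyps d s)
  weakenHyps (∀I d) s = ∀I (weakenHyps d (map⁺ wk s))
  weakenHyps (∀E d x) s = ∀E (weakenHyps d s) x
  weakenHyps (raa d) s = raa (weakenHyps d (∷⁺ʳ _ s))
  weakenHyps (≐refl x) s = ≐refl x
  weakenHyps (≐subst φ d e) s = ≐subst φ (weakenHyps d s) (weakenHyps e s)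

  weakenHyp : ∀ {Γ Δ φ ψ} → Der T Γ Δ φ → Der T Γ (ψ ∷ Δ) φ
  weakenHyp d = weakenHyps d (xs⊆x∷xs _ _)

  cast : ∀ {Γ Δ φ ψ} → φ ≡ ψ → Der T Γ Δ φ → Der T Γ Δ ψ
  cast = subst (Der T _ _)

  module _ {{_ : RenameClosed T}} where
    map-rename-ext-wk : ∀ {Γ Γ' m} (ρ : Ren Γ Γ') (Δ : List (Formula S Γ)) →
                        map (rename (ext {m = m} ρ)) (map wk Δ) ≡ map wk (map (rename ρ) Δ)
    map-rename-ext-wk ρ [] = refl
    map-rename-ext-wk ρ (φ ∷ Δ) = cong₂ _∷_ (rename-ext-wk ρ φ) (map-rename-ext-wk ρ Δ)

    renameDer : ∀ {Γ Γ' Δ φ} (ρ : Ren Γ Γ') → Der T Γ Δ φ → Der T Γ' (map (rename ρ) Δ) (rename ρ φ)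
    renameDer ρ (ax t) = ax (rename-axiom ρ t)
    renameDer ρ (hyp m) = hyp (∈-map⁺ (rename ρ) m)
    renameDer ρ (⇒I d) = ⇒I (renameDer ρ d)
    renameDer ρ (⇒E d e) = ⇒E (renameDer ρ d) (renameDer ρ e)
    renameDer ρ (∧I d e) = ∧I (renameDer ρ d) (renameDer ρ e)
    renameDer ρ (∧E₁ d) = ∧E₁ (renameDer ρ d)
    renameDer ρ (∧E₂ d) = ∧E₂ (renameDer ρ d)
    renameDer ρ (∀I {Δ = Δ} d) = ∀I (subst (λ Θ → Der T _ Θ _) (map-rename-ext-wk ρ Δ) (renameDer (ext ρ) d))
    renameDer ρ (∀E {φ = φ} d x) = cast (sym (rename-[] ρ φ x)) (∀E (renameDer ρ d) (ρ x))
    renameDer ρ (raa d) = raa (renameDer ρ d)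
    renameDer ρ (≐refl x) = ≐refl (ρ x)
    renameDer ρ (≐subst {x = x} {y} φ d e) =
      cast (sym (rename-[] ρ φ y))
        (≐subst (rename (ext ρ) φ) (renameDer ρ d) (cast (rename-[] ρ φ x) (renameDer ρ e)))

    wkDer : ∀ {Γ Δ φ n} → Der T Γ Δ φ → Der T (n ∷ Γ) (map wk Δ) (wk φ)
    wkDer d = renameDer there d

module _ {S₁ S₂ : Sig} {T₁ : Theory S₁} {T₂ : Theory S₂} (τ : Transl S₁ S₂)
         (translate-axiom : ∀ {Γ φ} → T₁ Γ φ → Der T₂ Γ [] (translate τ φ)) where
  translateDer : ∀ {Γ Δ φ} → Der T₁ Γ Δ φ → Der T₂ Γ (map (translate τ) Δ) (translate τ φ)
  translateDer (ax t) = weakenHyps (translate-axiom t) (λ ())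
  translateDer (hyp m) = hyp (∈-map⁺ (translate τ) m)
  translateDer (⇒I d) = ⇒I (translateDer d)
  translateDer (⇒E d e) = ⇒E (translateDer d) (translateDer e)
  translateDer (∧I d e) = ∧I (translateDer d) (translateDer e)
  translateDer (∧E₁ d) = ∧E₁ (translateDer d)
  translateDer (∧E₂ d) = ∧E₂ (translateDer d)
  translateDer (∀I {Δ = Δ} d) = ∀I (subst (λ Θ → Der T₂ _ Θ _) (map-translate-wk τ Δ) (translateDer d))
  translateDer (∀E {φ = φ} d x) = cast (sym (translate-rename τ (sub₁ x) φ)) (∀E (translateDer d) x)
  translateDer (raa d) = raa (translateDer d)
  translateDer (≐refl x) = ≐refl x
  translateDer (≐subst {x = x} {y} φ d e) =
    cast (sym (translate-rename τ (sub₁ y) φ))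
      (≐subst (translate τ φ) (translateDer d) (cast (translate-rename τ (sub₁ x) φ) (translateDer e)))

  translate-provable : ∀ Γ φ → Provable T₁ Γ φ → Provable T₂ Γ (translate τ φ)
  translate-provable Γ φ (Ψ , d) = Ψ , cast (translate-rename τ (wkᴾ Ψ) φ) (translateDer d)

Der⇒Provable : ∀ {S} {T : Theory S} {Γ φ} → Der T Γ [] φ → Provable T Γ φ
Der⇒Provable d = [] , cast (sym (rename-id _)) d

STTdown-rename : ∀ {Γ Γ'} (ρ : Ren Γ Γ') {φ} → STTdown Γ φ → STTdown Γ' (rename ρ φ)
STTdown-rename ρ (compSTT n φ) = subst (STTdown _)
  (cong (λ χ → ∃' (suc n) (∀' n (rel (app n) (there here ∷ here ∷ []) ⇔ χ))) (sym (rename-ext²-wk₁ ρ φ)))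
  (compSTT n (rename (ext ρ) φ))
STTdown-rename ρ (ident n) = ident n
STTdown-rename ρ (comp₀ φ) = subst (STTdown _)
  (cong (λ χ → ∃' 1 (∀' 0 (rel (app 0) (there here ∷ here ∷ []) ⇔ χ))) (sym (rename-ext²-wk₁ ρ φ)))
  (comp₀ (rename (ext ρ) φ))
STTdown-rename ρ (compDown k φ) = subst (STTdown _)
  (cong (λ χ → ∀' (suc k) (∃' (suc (suc k))
      (rel (down k) (here ∷ there here ∷ []) ∧ ∀' (suc k) (rel (app (suc k)) (there here ∷ here ∷ []) ⇔ χ))))
    (sym (rename-ext²-wk₁ (ext ρ) φ)))
  (compDown k (rename (ext (ext ρ)) φ))
STTdown-rename ρ (downEx k) = downEx k
STTdown-rename ρ (downSim zero) = downSim zero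
STTdown-rename ρ (downSim (suc k)) = downSim (suc k)
STTdown-rename ρ (downMax zero) = downMax zero
STTdown-rename ρ (downMax (suc k)) = downMax (suc k)

instance
  STTdown-renameClosed : RenameClosed STTdown
  STTdown-renameClosed = record { rename-axiom = STTdown-rename }

fjtClause : ∀ {Γ} (k : ℕ) → ((i : Fin (suc k)) → Formula FJSig (toℕ i ∷ Γ)) →
            Fin (suc k) → Formula FJSig (suc k ∷ Γ)
fjtClause k φ i = ∀' (toℕ i) (rel (app (suc k) (toℕ i) (toℕ<n i)) (there here ∷ here ∷ []) ⇔ wk₁ (φ i))

FJT-rename : ∀ {Γ Γ'} (ρ : Ren Γ Γ') {φ} → FJT Γ φ → FJT Γ' (rename ρ φ)
FJT-rename ρ (comp k φ) = subst (FJT _) (cong (∃' (suc k)) (sym clauses)) (comp k (λ i → rename (ext ρ) (φ i)))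
  where
    clauses : rename (ext ρ) (⋀ k (fjtClause k φ)) ≡ ⋀ k (fjtClause k (λ i → rename (ext ρ) (φ i)))
    clauses = trans (rename-⋀ (ext ρ) k _) (⋀-cong k (λ i →
      cong (λ χ → ∀' (toℕ i) (rel (app (suc k) (toℕ i) (toℕ<n i)) (there here ∷ here ∷ []) ⇔ χ))
           (rename-ext²-wk₁ ρ (φ i))))

instance
  FJT-renameClosed : RenameClosed FJT
  FJT-renameClosed = record { rename-axiom = FJT-rename }

module _ {S : Sig} {T : Theory S} {{_ : RenameClosed T}} where
  hyp₀ : ∀ {Γ Δ φ} → Der T Γ (φ ∷ Δ) φ
  hyp₀ = hyp (Any.here refl)

  hyp₁ : ∀ {Γ Δ φ ψ} → Der T Γ (ψ ∷ φ ∷ Δ) φ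
  hyp₁ = hyp (Any.there (Any.here refl))

  ⊤I : ∀ {Γ Δ} → Der T Γ Δ ⊤'
  ⊤I = ⇒I hyp₀

  liftDer : ∀ {Γ Δ φ n ψ} → Der T Γ Δ φ → Der T (n ∷ Γ) (ψ ∷ map wk Δ) (wk φ)
  liftDer d = weakenHyp (wkDer d)

  ∀E-here : ∀ {Γ Δ n φ} → Der T Γ Δ (∀' n φ) → Der T (n ∷ Γ) (map wk Δ) φ
  ∀E-here {φ = φ} d = cast (wk-[here] φ) (∀E (wkDer d) here)

  ∃I : ∀ {Γ Δ n φ} (x : Γ ∋ n) → Der T Γ Δ (φ [ x ]) → Der T Γ Δ (∃' n φ)
  ∃I x d = ⇒I (⇒E (∀E hyp₀ x) (weakenHyp d))

  ∃E : ∀ {Γ Δ n φ ψ} → Der T Γ Δ (∃' n φ) → Der T (n ∷ Γ) (φ ∷ map wk Δ) (wk ψ) → Der T Γ Δ ψ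
  ∃E d e = raa (⇒E (weakenHyp d) (∀I (⇒I (⇒E hyp₁ (weakenHyps e (∷⁺ʳ _ (xs⊆x∷xs _ _)))))))

  ∃-map : ∀ {Γ Δ n φ ψ} → Der T Γ Δ (∃' n φ) → Der T (n ∷ Γ) (φ ∷ map wk Δ) ψ → Der T Γ Δ (∃' n ψ)
  ∃-map {ψ = ψ} d e = ∃E d (∃I here (cast (sym (wk-[here] ψ)) e))

  ⇔I : ∀ {Γ Δ φ ψ} → Der T Γ (φ ∷ Δ) ψ → Der T Γ (ψ ∷ Δ) φ → Der T Γ Δ (φ ⇔ ψ)
  ⇔I a b = ∧I (⇒I a) (⇒I b)

  ⇔E→ : ∀ {Γ Δ φ ψ} → Der T Γ Δ (φ ⇔ ψ) → Der T Γ Δ φ → Der T Γ Δ ψ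
  ⇔E→ d e = ⇒E (∧E₁ d) e

  ⇔E← : ∀ {Γ Δ φ ψ} → Der T Γ Δ (φ ⇔ ψ) → Der T Γ Δ ψ → Der T Γ Δ φ
  ⇔E← d e = ⇒E (∧E₂ d) e

  ⇔-refl : ∀ {Γ Δ φ} → Der T Γ Δ (φ ⇔ φ)
  ⇔-refl = ⇔I hyp₀ hyp₀

  ⇔-sym : ∀ {Γ Δ φ ψ} → Der T Γ Δ (φ ⇔ ψ) → Der T Γ Δ (ψ ⇔ φ)
  ⇔-sym d = ∧I (∧E₂ d) (∧E₁ d)

  ⇔-trans : ∀ {Γ Δ φ ψ χ} → Der T Γ Δ (φ ⇔ ψ) → Der T Γ Δ (ψ ⇔ χ) → Der T Γ Δ (φ ⇔ χ)
  ⇔-trans d e = ⇔I (⇔E→ (weakenHyp e) (⇔E→ (weakenHyp d) hyp₀)) (⇔E← (weakenHyp d) (⇔E← (weakenHyp e) hyp₀))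

  ∀⇔-sym : ∀ {Γ Δ n φ ψ} → Der T Γ Δ (∀' n (φ ⇔ ψ)) → Der T Γ Δ (∀' n (ψ ⇔ φ))
  ∀⇔-sym d = ∀I (⇔-sym (∀E-here d))

  ∀⇔-trans : ∀ {Γ Δ n φ ψ χ} → Der T Γ Δ (∀' n (φ ⇔ ψ)) → Der T Γ Δ (∀' n (ψ ⇔ χ)) →
             Der T Γ Δ (∀' n (φ ⇔ χ))
  ∀⇔-trans d e = ∀I (⇔-trans (∀E-here d) (∀E-here e))

  ≐-sym : ∀ {Γ Δ n} {a b : Γ ∋ n} → Der T Γ Δ (a ≐ b) → Der T Γ Δ (b ≐ a)
  ≐-sym {a = a} d = ≐subst (here ≐ there a) d (≐refl a)

-- Agreement of families of formulas at all types t ≤′ k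

≤′-irrelevant : ∀ {m n} (p q : m ≤′ n) → p ≡ q
≤′-irrelevant (≤′-reflexive p) (≤′-reflexive q) = cong ≤′-reflexive (≡-irrelevant p q)
≤′-irrelevant ≤′-refl (≤′-step q) = contradiction (≤′⇒≤ q) (<-irrefl refl)
≤′-irrelevant (≤′-step p) ≤′-refl = contradiction (≤′⇒≤ p) (<-irrefl refl)
≤′-irrelevant (≤′-step p) (≤′-step q) = cong ≤′-step (≤′-irrelevant p q)

<suc⇒≤′ : ∀ {m k} → m < suc k → m ≤′ k
<suc⇒≤′ (s≤s p) = ≤⇒≤′ p

≤′⇒<suc : ∀ {m k} → m ≤′ k → m < suc k
≤′⇒<suc h = s≤s (≤′⇒≤ h)

toℕ≤′ : ∀ {k} (i : Fin (suc k)) → toℕ i ≤′ k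
toℕ≤′ i = <suc⇒≤′ (toℕ<n i)

module _ {S : Sig} where
  ⋀≤ : ∀ {Γ} (k : ℕ) → ((t : ℕ) → t ≤′ k → Formula S Γ) → Formula S Γ
  ⋀≤ k Q = ⋀ k (λ i → Q (toℕ i) (toℕ≤′ i))

  rename-⋀≤ : ∀ {Γ Δ} (ρ : Ren Γ Δ) (k : ℕ) (Q : (t : ℕ) → t ≤′ k → Formula S Γ) →
              rename ρ (⋀≤ k Q) ≡ ⋀≤ k (λ t h → rename ρ (Q t h))
  rename-⋀≤ ρ k Q = rename-⋀ ρ k _

  ⋀≤-cong : ∀ {Γ} (k : ℕ) {Q Q' : (t : ℕ) → t ≤′ k → Formula S Γ} →
            (∀ t h → Q t h ≡ Q' t h) → ⋀≤ k Q ≡ ⋀≤ k Q'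
  ⋀≤-cong k e = ⋀-cong k (λ i → e (toℕ i) (toℕ≤′ i))

  module _ {T : Theory S} where
    ⋀-intro : ∀ {Γ Δ} (k : ℕ) {f : Fin (suc k) → Formula S Γ} → (∀ i → Der T Γ Δ (f i)) → Der T Γ Δ (⋀ k f)
    ⋀-intro zero d = d fzero
    ⋀-intro (suc k) d = ∧I (d fzero) (⋀-intro k (λ i → d (fsuc i)))

    ⋀-elim : ∀ {Γ Δ} (k : ℕ) {f : Fin (suc k) → Formula S Γ} → Der T Γ Δ (⋀ k f) → ∀ i → Der T Γ Δ (f i)
    ⋀-elim zero d fzero = d
    ⋀-elim (suc k) d fzero = ∧E₁ d
    ⋀-elim (suc k) d (fsuc i) = ⋀-elim k (∧E₂ d) i

    ⋀≤-intro : ∀ {Γ Δ} (k : ℕ) {Q : (t : ℕ) → t ≤′ k → Formula S Γ} →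
               (∀ t h → Der T Γ Δ (Q t h)) → Der T Γ Δ (⋀≤ k Q)
    ⋀≤-intro k d = ⋀-intro k (λ i → d (toℕ i) (toℕ≤′ i))

    ⋀≤-elim : ∀ {Γ Δ} (k : ℕ) {Q : (t : ℕ) → t ≤′ k → Formula S Γ} →
              Der T Γ Δ (⋀≤ k Q) → ∀ t h → Der T Γ Δ (Q t h)
    ⋀≤-elim k {Q} d t h = conjunct (toℕ-fromℕ< (≤′⇒<suc h)) (toℕ≤′ i) h (⋀-elim k d i)
      where
        i = fromℕ< (≤′⇒<suc h)
        conjunct : ∀ {t t'} → t ≡ t' → (h : t ≤′ k) (h' : t' ≤′ k) → Der T _ _ (Q t h) → Der T _ _ (Q t' h')
        conjunct refl h h' d rewrite ≤′-irrelevant h h' = d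

module _ {S₁ S₂ : Sig} (τ : Transl S₁ S₂) where
  translate-⋀≤ : ∀ {Γ} (k : ℕ) (Q : (t : ℕ) → t ≤′ k → Formula S₁ Γ) →
                 translate τ (⋀≤ k Q) ≡ ⋀≤ k (λ t h → translate τ (Q t h))
  translate-⋀≤ k Q = translate-⋀ τ k (λ i → Q (toℕ i) (toℕ≤′ i))

Family : Sig → List ℕ → ℕ → Set
Family S Γ k = (t : ℕ) → t ≤′ k → Formula S (t ∷ Γ)

module _ {S : Sig} where
  opaque
    agree : ∀ {Γ} (k : ℕ) → Family S Γ k → Family S Γ k → Formula S Γ
    agree k P Q = ⋀≤ k (λ t h → ∀' t (P t h ⇔ Q t h))

    agree-unfold : ∀ {Γ} (k : ℕ) (P Q : Family S Γ k) → agree k P Q ≡ ⋀≤ k (λ t h → ∀' t (P t h ⇔ Q t h))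
    agree-unfold k P Q = refl

  lower : ∀ {Γ k} → Family S Γ (suc k) → Family S Γ k
  lower P t h = P t (≤′-step h)

  renameFamily : ∀ {Γ Δ k} → Ren Γ Δ → Family S Γ k → Family S Δ k
  renameFamily ρ P t h = rename (ext ρ) (P t h)

  renameFamily-fuse : ∀ {Γ Δ Θ k} {ρ : Ren Γ Δ} {σ : Ren Δ Θ} {τ : Ren Γ Θ} →
                      (∀ {n} (v : Γ ∋ n) → σ (ρ v) ≡ τ v) → (P : Family S Γ k) →
                      ∀ t h → renameFamily σ (renameFamily ρ P) t h ≡ renameFamily τ P t h
  renameFamily-fuse e P t h = rename-fuse (ext-fuse e) (P t h)

  rename-agree : ∀ {Γ Δ} (ρ : Ren Γ Δ) (k : ℕ) (P Q : Family S Γ k) →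
                 rename ρ (agree k P Q) ≡ agree k (renameFamily ρ P) (renameFamily ρ Q)
  rename-agree ρ k P Q = begin
    rename ρ (agree k P Q)                         ≡⟨ cong (rename ρ) (agree-unfold k P Q) ⟩
    rename ρ (⋀≤ k (λ t h → ∀' t (P t h ⇔ Q t h)))  ≡⟨ rename-⋀≤ ρ k (λ t h → ∀' t (P t h ⇔ Q t h)) ⟩
    ⋀≤ k (λ t h → rename ρ (∀' t (P t h ⇔ Q t h)))  ≡⟨ sym (agree-unfold k _ _) ⟩
    agree k (renameFamily ρ P) (renameFamily ρ Q)  ∎
    where open ≡-Reasoning

  agree-cong : ∀ {Γ} (k : ℕ) {P P' Q Q' : Family S Γ k} →
               (∀ t h → P t h ≡ P' t h) → (∀ t h → Q t h ≡ Q' t h) → agree k P Q ≡ agree k P' Q'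
  agree-cong k {P} {P'} {Q} {Q'} eP eQ =
    trans (agree-unfold k P Q)
      (trans (⋀≤-cong k (λ t h → cong₂ (λ φ ψ → ∀' t (φ ⇔ ψ)) (eP t h) (eQ t h))) (sym (agree-unfold k P' Q')))

  module _ {T : Theory S} {{_ : RenameClosed T}} {Γ : List ℕ} {Δ : List (Formula S Γ)} where
    agree-intro : ∀ (k : ℕ) (P Q : Family S Γ k) →
                  (∀ t h → Der T Γ Δ (∀' t (P t h ⇔ Q t h))) → Der T Γ Δ (agree k P Q)
    agree-intro k P Q d = cast (sym (agree-unfold k P Q)) (⋀≤-intro k d)

    agree-elim : ∀ (k : ℕ) (P Q : Family S Γ k) →
                 Der T Γ Δ (agree k P Q) → ∀ t h → Der T Γ Δ (∀' t (P t h ⇔ Q t h))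
    agree-elim k P Q d = ⋀≤-elim k (cast (agree-unfold k P Q) d)

    agree-sym : ∀ {k} {P Q : Family S Γ k} → Der T Γ Δ (agree k P Q) → Der T Γ Δ (agree k Q P)
    agree-sym {k} {P} {Q} d = agree-intro k Q P (λ t h → ∀⇔-sym (agree-elim k P Q d t h))

    agree-trans : ∀ {k} {P Q R : Family S Γ k} →
                  Der T Γ Δ (agree k P Q) → Der T Γ Δ (agree k Q R) → Der T Γ Δ (agree k P R)
    agree-trans {k} {P} {Q} {R} d e =
      agree-intro k P R (λ t h → ∀⇔-trans (agree-elim k P Q d t h) (agree-elim k Q R e t h))

    agree-lower : ∀ {k} {P Q : Family S Γ (suc k)} →
                  Der T Γ Δ (agree (suc k) P Q) → Der T Γ Δ (agree k (lower P) (lower Q))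
    agree-lower {k} {P} {Q} d = agree-intro k (lower P) (lower Q) (λ t h → agree-elim (suc k) P Q d t (≤′-step h))

module _ {S₁ S₂ : Sig} (τ : Transl S₁ S₂) where
  translate-agree : ∀ {Γ} (k : ℕ) (P Q : Family S₁ Γ k) →
                    translate τ (agree k P Q) ≡ agree k (λ t h → translate τ (P t h)) (λ t h → translate τ (Q t h))
  translate-agree k P Q =
    trans (cong (translate τ) (agree-unfold k P Q))
      (trans (translate-⋀≤ τ k (λ t h → ∀' t (P t h ⇔ Q t h))) (sym (agree-unfold k _ _)))

-- Descents in STT↓

applyS : ∀ {Γ} (n : ℕ) → Γ ∋ suc n → Γ ∋ n → Formula SSig Γ
applyS n b a = rel (app n) (b ∷ a ∷ [])

downS : ∀ {Γ} (k : ℕ) → Γ ∋ suc (suc k) → Γ ∋ suc k → Formula SSig Γ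
downS k z y = rel (down k) (z ∷ y ∷ [])

-- b(a) for b of type k+1 and a of type m ≤ k: ∃c (b ⇝ c ∧ c(a)), iterated k − m times.
app↓ : ∀ {Γ m k} → m ≤′ k → Γ ∋ suc k → Γ ∋ m → Formula SSig Γ
app↓ {m = m} ≤′-refl b a = applyS m b a
app↓ (≤′-step {k} g) b a = ∃' (suc k) (downS k (there b) here ∧ app↓ g here (there a))

rename-app↓ : ∀ {Γ Γ' m k} (ρ : Ren Γ Γ') (g : m ≤′ k) (b : Γ ∋ suc k) (a : Γ ∋ m) →
              rename ρ (app↓ g b a) ≡ app↓ g (ρ b) (ρ a)
rename-app↓ ρ ≤′-refl b a = refl
rename-app↓ ρ (≤′-step {k} g) b a =
  cong (λ χ → ∃' (suc k) (downS k (there (ρ b)) here ∧ χ)) (rename-app↓ (ext ρ) g here (there a))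

members↓ : ∀ {Γ k} → Γ ∋ suc k → Family SSig Γ k
members↓ z t h = app↓ h (there z) here

rename-members↓ : ∀ {Γ Γ' k} (ρ : Ren Γ Γ') (z : Γ ∋ suc k) →
                  ∀ t h → renameFamily ρ (members↓ z) t h ≡ members↓ (ρ z) t h
rename-members↓ ρ z t h = rename-app↓ (ext ρ) h (there z) here

defines↓ : ∀ {Γ} (k : ℕ) → Γ ∋ suc k → Family SSig Γ k → Formula SSig Γ
defines↓ k z ψ = agree k (members↓ z) ψ

sameExt : ∀ {Γ} (k : ℕ) → Γ ∋ suc k → Γ ∋ suc k → Formula SSig Γ
sameExt k a b = defines↓ k a (members↓ b)

sameExt↓ : ∀ {Γ} (k : ℕ) → Γ ∋ suc (suc k) → Γ ∋ suc k → Formula SSig Γ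
sameExt↓ k z y = agree k (lower (members↓ z)) (members↓ y)

rename-defines↓ : ∀ {Γ Γ'} (ρ : Ren Γ Γ') (k : ℕ) (z : Γ ∋ suc k) (ψ : Family SSig Γ k) →
                  rename ρ (defines↓ k z ψ) ≡ defines↓ k (ρ z) (renameFamily ρ ψ)
rename-defines↓ ρ k z ψ = trans (rename-agree ρ k _ _) (agree-cong k (rename-members↓ ρ z) (λ _ _ → refl))

rename-sameExt : ∀ {Γ Γ'} (ρ : Ren Γ Γ') (k : ℕ) (a b : Γ ∋ suc k) →
                 rename ρ (sameExt k a b) ≡ sameExt k (ρ a) (ρ b)
rename-sameExt ρ k a b = trans (rename-defines↓ ρ k a _) (agree-cong k (λ _ _ → refl) (rename-members↓ ρ b))

rename-sameExt↓ : ∀ {Γ Γ'} (ρ : Ren Γ Γ') (k : ℕ) (z : Γ ∋ suc (suc k)) (y : Γ ∋ suc k) →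
                  rename ρ (sameExt↓ k z y) ≡ sameExt↓ k (ρ z) (ρ y)
rename-sameExt↓ ρ k z y =
  trans (rename-agree ρ k _ _) (agree-cong k (λ t h → rename-members↓ ρ z t (≤′-step h)) (rename-members↓ ρ y))

down-exists : ∀ {Γ Δ k} (z : Γ ∋ suc (suc k)) → Der STTdown Γ Δ (∃' (suc k) (downS k (there z) here))
down-exists {k = k} z = ∀E (ax (downEx k)) z

down-sim : ∀ {Γ Δ} (k : ℕ) (z : Γ ∋ suc (suc k)) (x y : Γ ∋ suc k) →
           Der STTdown Γ Δ (downS k z x) → Der STTdown Γ Δ (downS k z y) →
           Der STTdown Γ Δ (sim k x y ∧ approx k y x)
down-sim zero z x y d e = ⇒E (∀E (∀E (∀E (ax (downSim zero)) z) x) y) (∧I d e)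
down-sim (suc k) z x y d e = ⇒E (∀E (∀E (∀E (ax (downSim (suc k))) z) x) y) (∧I d e)

down-max : ∀ {Γ Δ} (k : ℕ) (z : Γ ∋ suc (suc k)) (x y : Γ ∋ suc k) →
           Der STTdown Γ Δ (downS k z x) → Der STTdown Γ Δ (sim k x y) → Der STTdown Γ Δ (approx k y x) →
           Der STTdown Γ Δ (downS k z y)
down-max zero z x y d e f = ⇒E (∀E (∀E (∀E (ax (downMax zero)) z) x) y) (∧I d (∧I e f))
down-max (suc k) z x y d e f = ⇒E (∀E (∀E (∀E (ax (downMax (suc k))) z) x) y) (∧I d (∧I e f))

app↓-resp-≃≈ : ∀ {Γ Δ m k} (g : m ≤′ k) (c c' : Γ ∋ suc k) (x : Γ ∋ m) →
               Der STTdown Γ Δ (sim k c c') → Der STTdown Γ Δ (approx k c' c) →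
               Der STTdown Γ Δ (app↓ g c x) → Der STTdown Γ Δ (app↓ g c' x)
app↓-resp-≃≈ ≤′-refl c c' x s a d = ⇔E→ (∀E s x) d
app↓-resp-≃≈ (≤′-step {k} g) c c' x s a d =
  ∃E d (cast (cong (λ χ → ∃' (suc k) (downS k (there (there c')) here ∧ χ))
                   (sym (rename-app↓ (ext there) g here (there x))))
    (∃I here (cast (cong (downS k (there c') here ∧_) (sym (rename-app↓ (sub₁ here) g here (there (there x)))))
      (∧I (⇔E← (∀E (liftDer a) here) (∧E₁ hyp₀)) (∧E₂ hyp₀)))))

-- The first descent step may go to any c with b ⇝ c, since all such c are ≃ and ≈ (Down_Sim).
app↓-step : ∀ {Γ Δ m k} (g : m ≤′ k) (b : Γ ∋ suc (suc k)) (c : Γ ∋ suc k) (x : Γ ∋ m) →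
            Der STTdown Γ Δ (downS k b c) → Der STTdown Γ Δ (app↓ (≤′-step g) b x ⇔ app↓ g c x)
app↓-step {k = k} g b c x d = ⇔I
  (∃E hyp₀ (cast (sym (rename-app↓ there g c x))
    (let s = down-sim k (there b) here (there c) (∧E₁ hyp₀) (liftDer (weakenHyp d)) in
     app↓-resp-≃≈ g here (there c) (there x) (∧E₁ s) (∧E₂ s) (∧E₂ hyp₀))))
  (∃I c (cast (cong (downS k b c ∧_) (sym (rename-app↓ (sub₁ c) g here (there x)))) (∧I (weakenHyp d) hyp₀)))

⇝⇒sameExt↓ : ∀ {Γ Δ k} {z : Γ ∋ suc (suc k)} {y : Γ ∋ suc k} →
             Der STTdown Γ Δ (downS k z y) → Der STTdown Γ Δ (sameExt↓ k z y)
⇝⇒sameExt↓ {k = k} {z} {y} d = agree-intro k _ _ (λ t h → ∀I (app↓-step h (there z) (there y) here (wkDer d)))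

mutual
  sameExt⇒≃≈ : ∀ {Γ Δ} (k : ℕ) (c y : Γ ∋ suc k) → Der STTdown Γ Δ (sameExt k c y) →
               Der STTdown Γ Δ (sim k c y ∧ approx k y c)
  sameExt⇒≃≈ zero c y d = ∧I (agree-elim zero _ _ d zero ≤′-refl) ⊤I
  sameExt⇒≃≈ (suc j) c y d = ∧I (agree-elim (suc j) _ _ d (suc j) ≤′-refl)
    (∀I (⇔I (sameExt-⇝ j (there y) (there c) here (liftSameExt (agree-sym d)) hyp₀)
            (sameExt-⇝ j (there c) (there y) here (liftSameExt d) hyp₀)))
    where
      liftSameExt : ∀ {a b} → Der STTdown _ _ (sameExt (suc j) a b) →
                    Der STTdown _ (downS j (there _) here ∷ _) (sameExt (suc j) (there a) (there b))
      liftSameExt e = cast (rename-sameExt there (suc j) _ _) (liftDer e)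

  -- With y ⇝ w′, w′ has the same members as c's members one level down, hence as w; so w′ ≃ w, w ≈ w′ and
  -- Down_Max gives y ⇝ w.
  sameExt-⇝ : ∀ {Γ Δ} (j : ℕ) (c y : Γ ∋ suc (suc j)) (w : Γ ∋ suc j) →
              Der STTdown Γ Δ (sameExt (suc j) c y) → Der STTdown Γ Δ (downS j c w) → Der STTdown Γ Δ (downS j y w)
  sameExt-⇝ {Γ} {Δ} j c y w c≡y c⇝w =
    ∃E (down-exists y) (down-max j (there y) here (there w) hyp₀ (∧E₁ w′~w) (∧E₂ w′~w))
    where
      Δ′ : List (Formula SSig (suc j ∷ Γ))
      Δ′ = downS j (there y) here ∷ map wk Δ
      c≡y′ : Der STTdown (suc j ∷ Γ) Δ′ (sameExt (suc j) (there c) (there y))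
      c≡y′ = cast (rename-sameExt there (suc j) c y) (liftDer c≡y)
      w′~w : Der STTdown (suc j ∷ Γ) Δ′ (sim j here (there w) ∧ approx j (there w) here)
      w′~w = sameExt⇒≃≈ j here (there w) (agree-trans (agree-sym (⇝⇒sameExt↓ hyp₀))
               (agree-trans (agree-lower (agree-sym c≡y′)) (⇝⇒sameExt↓ (liftDer c⇝w))))

⇝⇔sameExt↓ : ∀ {Γ Δ} (k : ℕ) (z : Γ ∋ suc (suc k)) (y : Γ ∋ suc k) →
             Der STTdown Γ Δ (downS k z y ⇔ sameExt↓ k z y)
⇝⇔sameExt↓ {Γ} {Δ} k z y = ⇔I (⇝⇒sameExt↓ hyp₀)
  (∃E (down-exists z) (down-max k (there z) here (there y) hyp₀ (∧E₁ y′~y) (∧E₂ y′~y)))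
  where
    Δ′ : List (Formula SSig (suc k ∷ Γ))
    Δ′ = downS k (there z) here ∷ map wk (sameExt↓ k z y ∷ Δ)
    y′~y : Der STTdown (suc k ∷ Γ) Δ′ (sim k here (there y) ∧ approx k (there y) here)
    y′~y = sameExt⇒≃≈ k here (there y) (agree-trans (agree-sym (⇝⇒sameExt↓ hyp₀))
             (cast (rename-sameExt↓ there k z y) (liftDer hyp₀)))

-- Interpreting FJT in STT↓

FJT→STT : Transl FJSig SSig
FJT→STT (app (suc k) m (s≤s q)) = app↓ (≤⇒≤′ q) here (there here)

translate-FJT→STT-app : ∀ {Γ k m} (p : m < suc k) (b : Γ ∋ suc k) (a : Γ ∋ m) →
                        translate FJT→STT (rel (app (suc k) m p) (b ∷ a ∷ [])) ≡ app↓ (<suc⇒≤′ p) b a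
translate-FJT→STT-app (s≤s q) b a = rename-app↓ (lookupArg (b ∷ a ∷ [])) (≤⇒≤′ q) here (there here)

comprehension↓ : ∀ {Γ Δ k} (y : Γ ∋ suc k) (χ : Formula SSig (suc k ∷ Γ)) →
                 Der STTdown Γ Δ (∃' (suc (suc k)) (downS k here (there y)
                   ∧ ∀' (suc k) (applyS (suc k) (there here) here ⇔ rename (ext there) χ)))
comprehension↓ {k = k} y χ =
  cast (cong (λ φ → ∃' (suc (suc k)) (downS k here (there y) ∧ ∀' (suc k) (applyS (suc k) (there here) here ⇔ φ)))
             instance-y)
    (∀E (ax (compDown k (rename (ext there) χ))) y)
  where
    instance-y : rename (ext (ext (sub₁ y))) (wk₁ (rename (ext there) χ)) ≡ rename (ext there) χ
    instance-y = trans (cong (rename (ext (ext (sub₁ y)))) (rename-∘ (ext there) (ext there) χ)) (rename-fuse pointwise χ)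
      where pointwise : ∀ {n} (v : (suc k ∷ _) ∋ n) → ext (ext (sub₁ y)) (ext there (ext there v)) ≡ ext there v
            pointwise here = refl
            pointwise (there v) = refl

defines↓-extend : ∀ {Γ Δ k} (ψ : Family SSig Γ (suc k)) (z : Γ ∋ suc (suc k)) (c : Γ ∋ suc k) →
                  Der STTdown Γ Δ (downS k z c) → Der STTdown Γ Δ (defines↓ k c (lower ψ)) →
                  Der STTdown Γ Δ (∀' (suc k) (applyS (suc k) (there z) here ⇔ ψ (suc k) ≤′-refl)) →
                  Der STTdown Γ Δ (defines↓ (suc k) z ψ)
defines↓-extend {k = k} ψ z c z⇝c below top = agree-intro (suc k) (members↓ z) ψ clause
  where
    clause : ∀ t h → Der STTdown _ _ (∀' t (members↓ z t h ⇔ ψ t h))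
    clause _ ≤′-refl = top
    clause t (≤′-step h) =
      ∀⇔-trans (agree-elim k _ _ (⇝⇒sameExt↓ z⇝c) t h) (agree-elim k (members↓ c) (lower ψ) below t h)

descComprehension : ∀ {Γ Δ} (k : ℕ) (ψ : Family SSig Γ k) →
                    Der STTdown Γ Δ (∃' (suc k) (defines↓ k here (renameFamily there ψ)))
descComprehension zero ψ =
  ∃-map (ax (comp₀ (ψ zero ≤′-refl))) (agree-intro zero _ _ λ { _ ≤′-refl → hyp₀ })
descComprehension {Γ} {Δ} (suc k) ψ =
  ∃E (descComprehension k (lower ψ))
    (cast (lift-goal there (renameFamily there ψ))
      (∃E (comprehension↓ here (renameFamily there ψ (suc k) ≤′-refl))
        (cast (lift-goal there (renameFamily (ext there) (renameFamily there ψ)))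
          (∃I here (cast witness-here extended)))))
  where
    Γ₂ : List ℕ
    Γ₂ = suc (suc k) ∷ suc k ∷ Γ
    ψ₂ : Family SSig Γ₂ (suc k)
    ψ₂ = renameFamily (λ v → there (there v)) ψ

    lift-goal : ∀ {Θ Θ′} (ρ : Ren Θ Θ′) (φ : Family SSig (suc (suc k) ∷ Θ) (suc k)) →
                ∃' (suc (suc k)) (defines↓ (suc k) here (renameFamily (ext ρ) φ))
                  ≡ rename ρ (∃' (suc (suc k)) (defines↓ (suc k) here φ))
    lift-goal ρ φ = cong (∃' (suc (suc k))) (sym (rename-defines↓ (ext ρ) (suc k) here φ))

    wk²-fuse : ∀ t h → renameFamily there (renameFamily there ψ) t h ≡ ψ₂ t h
    wk²-fuse = renameFamily-fuse (λ _ → refl) ψ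

    witness-here : defines↓ (suc k) here ψ₂ ≡
                   defines↓ (suc k) here (renameFamily (ext there) (renameFamily (ext there) (renameFamily there ψ))) [ here ]
    witness-here = sym (trans (rename-defines↓ (sub₁ here) (suc k) here _)
      (agree-cong (suc k) (λ _ _ → refl) (λ t h →
        trans (rename-∘ _ _ _) (trans (rename-∘ _ _ _) (trans (rename-∘ _ _ (ψ t h)) (rename-cong pointwise (ψ t h)))))))
      where pointwise : ∀ {t n} (v : (t ∷ Γ) ∋ n) →
                        ext (sub₁ here) (ext (ext there) (ext (ext there) (ext there v))) ≡ ext (λ w → there (there w)) v
            pointwise here = refl
            pointwise (there v) = refl

    extended : Der STTdown Γ₂ _ (defines↓ (suc k) here ψ₂)
    extended = defines↓-extend ψ₂ here (there here) (∧E₁ hyp₀)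
      (cast (trans (rename-defines↓ there k here _) (agree-cong k (λ _ _ → refl) (λ t h → wk²-fuse t (≤′-step h))))
            hyp₁)
      (cast (cong (λ φ → ∀' (suc k) (applyS (suc k) (there here) here ⇔ φ)) (wk²-fuse (suc k) ≤′-refl)) (∧E₂ hyp₀))

fromFinFamily : ∀ {P : ℕ → Set} (default : ∀ t → P t) (k : ℕ) → ((i : Fin (suc k)) → P (toℕ i)) → ∀ t → P t
fromFinFamily d k f zero = f fzero
fromFinFamily d zero f (suc t) = d (suc t)
fromFinFamily {P} d (suc k) f (suc t) = fromFinFamily {λ t → P (suc t)} (λ t → d (suc t)) k (λ i → f (fsuc i)) t

fromFinFamily-toℕ : ∀ {P : ℕ → Set} (d : ∀ t → P t) (k : ℕ) (f : (i : Fin (suc k)) → P (toℕ i)) (i : Fin (suc k)) →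
                    fromFinFamily d k f (toℕ i) ≡ f i
fromFinFamily-toℕ d k f fzero = refl
fromFinFamily-toℕ {P} d (suc k) f (fsuc i) = fromFinFamily-toℕ {λ t → P (suc t)} (λ t → d (suc t)) k (λ i → f (fsuc i)) i

FJT→STT-axiom : ∀ {Γ φ} → FJT Γ φ → Der STTdown Γ [] (translate FJT→STT φ)
FJT→STT-axiom {Γ} (comp k φ) = cast (cong (∃' (suc k)) (sym clauses)) (descComprehension k ψ)
  where
    φ↓ : (t : ℕ) → Formula SSig (t ∷ Γ)
    φ↓ = fromFinFamily (λ _ → ⊥') k (λ i → translate FJT→STT (φ i))
    ψ : Family SSig Γ k
    ψ t _ = φ↓ t
    clauses : translate FJT→STT (⋀ k (fjtClause k φ)) ≡ defines↓ k here (renameFamily there ψ)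
    clauses = begin
      translate FJT→STT (⋀ k (fjtClause k φ))                          ≡⟨ translate-⋀ FJT→STT k (fjtClause k φ) ⟩
      ⋀ k (λ i → translate FJT→STT (fjtClause k φ i))                  ≡⟨ ⋀-cong k clause ⟩
      ⋀≤ k (λ t h → ∀' t (members↓ here t h ⇔ renameFamily there ψ t h)) ≡⟨ sym (agree-unfold k _ _) ⟩
      defines↓ k here (renameFamily there ψ)                           ∎
      where
        open ≡-Reasoning
        clause : ∀ i → translate FJT→STT (fjtClause k φ i) ≡
                       ∀' (toℕ i) (members↓ here (toℕ i) (toℕ≤′ i) ⇔ renameFamily there ψ (toℕ i) (toℕ≤′ i))
        clause i = cong₂ (λ a b → ∀' (toℕ i) (a ⇔ b)) (translate-FJT→STT-app (toℕ<n i) (there here) here)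
          (trans (translate-rename FJT→STT (ext there) (φ i))
                 (cong wk₁ (sym (fromFinFamily-toℕ (λ _ → ⊥') k (λ i → translate FJT→STT (φ i)) i))))

-- Members and restrictions in FJT

appᶠ : ∀ {Γ n m} → m < n → Γ ∋ n → Γ ∋ m → Formula FJSig Γ
appᶠ p b a = rel (app _ _ p) (b ∷ a ∷ [])

appᶠ-irrelevant : ∀ {Γ n m} (p q : m < n) (b : Γ ∋ n) (a : Γ ∋ m) → appᶠ p b a ≡ appᶠ q b a
appᶠ-irrelevant p q b a = cong (λ r → appᶠ r b a) (≤-irrelevant p q)

applyᶠ : ∀ {Γ} (n : ℕ) → Γ ∋ suc n → Γ ∋ n → Formula FJSig Γ
applyᶠ n = appᶠ (≤′⇒<suc ≤′-refl)

membersᶠ : ∀ {Γ k} → Γ ∋ suc k → Family FJSig Γ k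
membersᶠ z t h = appᶠ (≤′⇒<suc h) (there z) here

restricts : ∀ {Γ} (k : ℕ) → Γ ∋ suc (suc k) → Γ ∋ suc k → Formula FJSig Γ
restricts k z y = agree k (lower (membersᶠ z)) (membersᶠ y)

rename-restricts : ∀ {Γ Γ'} (ρ : Ren Γ Γ') (k : ℕ) (z : Γ ∋ suc (suc k)) (y : Γ ∋ suc k) →
                   rename ρ (restricts k z y) ≡ restricts k (ρ z) (ρ y)
rename-restricts ρ k z y = rename-agree ρ k _ _

restricts-app : ∀ {Γ Δ m k} {z : Γ ∋ suc (suc k)} {y : Γ ∋ suc k} → Der FJT Γ Δ (restricts k z y) →
                (g : m ≤′ k) (a : Γ ∋ m) →
                Der FJT Γ Δ (appᶠ (≤′⇒<suc (≤′-step g)) z a ⇔ appᶠ (≤′⇒<suc g) y a)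
restricts-app {m = m} {k} d g a = ∀E (agree-elim k _ _ d m g) a

comprehensionᶠ : ∀ {Γ Δ} (k : ℕ) (ψ : Family FJSig Γ k) →
                 Der FJT Γ Δ (∃' (suc k) (agree k (membersᶠ here) (renameFamily there ψ)))
comprehensionᶠ k ψ = cast (cong (∃' (suc k)) (trans (⋀-cong k clause) (sym (agree-unfold k _ _))))
                          (ax (comp k (λ i → ψ (toℕ i) (toℕ≤′ i))))
  where
    clause : ∀ i → fjtClause k (λ i → ψ (toℕ i) (toℕ≤′ i)) i
                   ≡ ∀' (toℕ i) (membersᶠ here (toℕ i) (toℕ≤′ i) ⇔ renameFamily there ψ (toℕ i) (toℕ≤′ i))
    clause i = cong (λ χ → ∀' (toℕ i) (χ ⇔ wk₁ (ψ (toℕ i) (toℕ≤′ i)))) (appᶠ-irrelevant _ _ (there here) here)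

comprehension-top : ∀ {Γ Δ} (n : ℕ) (χ : Formula FJSig (n ∷ Γ)) →
                    Der FJT Γ Δ (∃' (suc n) (∀' n (applyᶠ n (there here) here ⇔ wk₁ χ)))
comprehension-top {Γ} n χ = ∃-map (comprehensionᶠ n top) (agree-elim n _ _ hyp₀ n ≤′-refl)
  where
    top : Family FJSig Γ n
    top _ ≤′-refl = χ
    top _ (≤′-step _) = ⊥'

comprehension↓ᶠ : ∀ {Γ Δ} (k : ℕ) (χ : Formula FJSig (suc k ∷ suc k ∷ Γ)) →
                  Der FJT Γ Δ (∀' (suc k) (∃' (suc (suc k)) (restricts k here (there here)
                    ∧ ∀' (suc k) (applyᶠ (suc k) (there here) here ⇔ wk₁ χ))))
comprehension↓ᶠ {Γ} k χ = ∀I (∃-map (comprehensionᶠ (suc k) ψ)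
  (∧I (agree-lower hyp₀) (agree-elim (suc k) _ _ hyp₀ (suc k) ≤′-refl)))
  where
    ψ : Family FJSig (suc k ∷ Γ) (suc k)
    ψ _ ≤′-refl = χ
    ψ t (≤′-step h) = membersᶠ here t h

restriction-exists : ∀ {Γ Δ} (k : ℕ) (z : Γ ∋ suc (suc k)) → Der FJT Γ Δ (∃' (suc k) (restricts k (there z) here))
restriction-exists k z = ∃-map (comprehensionᶠ k (lower (membersᶠ z))) (agree-sym hyp₀)

identityᶠ : ∀ {Γ Δ} (n : ℕ) → Der FJT Γ Δ (∀' n (∀' n ((there here ≐ here) ⇔
              ∀' (suc n) (applyᶠ n here (there (there here)) ⇔ applyᶠ n here (there here)))))
identityᶠ n = ∀I (∀I (⇔I
  (≐subst (∀' (suc n) (applyᶠ n here (there (there (there here))) ⇔ applyᶠ n here (there here))) hyp₀ (∀I ⇔-refl))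
  (∃E (comprehension-top n (here ≐ there (there here)))
    (let x∈z = ⇔E← (∀E hyp₀ (there (there here))) (≐refl (there (there here)))
         y∈z = ⇔E→ (∀E (liftDer hyp₀) here) x∈z
     in ≐-sym (⇔E→ (∀E hyp₀ (there here)) y∈z)))))

-- Interpreting STT↓ in FJT

STT→FJT : Transl SSig FJSig
STT→FJT (app n) = applyᶠ n here (there here)
STT→FJT (down k) = restricts k here (there here)

translate-down : ∀ {Γ} (k : ℕ) (z : Γ ∋ suc (suc k)) (y : Γ ∋ suc k) →
                 translate STT→FJT (downS k z y) ≡ restricts k z y
translate-down k z y = rename-restricts (lookupArg (z ∷ y ∷ [])) k here (there here)

sameᶠ : ∀ {Γ} (k : ℕ) → Γ ∋ suc k → Γ ∋ suc k → Formula FJSig Γ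
sameᶠ k a b = agree k (membersᶠ a) (membersᶠ b)

≈ᶠ : ∀ {Γ} (k : ℕ) → Γ ∋ suc k → Γ ∋ suc k → Formula FJSig Γ
≈ᶠ zero a b = ⊤'
≈ᶠ (suc j) a b = ∀' (suc j) (restricts j (there a) here ⇔ restricts j (there b) here)

rename-≈ᶠ : ∀ {Γ Γ'} (ρ : Ren Γ Γ') (k : ℕ) (a b : Γ ∋ suc k) → rename ρ (≈ᶠ k a b) ≡ ≈ᶠ k (ρ a) (ρ b)
rename-≈ᶠ ρ zero a b = refl
rename-≈ᶠ ρ (suc j) a b = cong₂ (λ φ ψ → ∀' (suc j) (φ ⇔ ψ))
  (rename-restricts (ext ρ) j (there a) here) (rename-restricts (ext ρ) j (there b) here)

translate-approx : ∀ {Γ} (k : ℕ) (a b : Γ ∋ suc k) → translate STT→FJT (approx k a b) ≡ ≈ᶠ k a b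
translate-approx zero a b = refl
translate-approx (suc j) a b =
  cong₂ (λ φ ψ → ∀' (suc j) (φ ⇔ ψ)) (translate-down j (there a) here) (translate-down j (there b) here)

≈ᶠ-elim : ∀ {Γ Δ} (j : ℕ) {a b : Γ ∋ suc (suc j)} → Der FJT Γ Δ (≈ᶠ (suc j) a b) →
          (w : Γ ∋ suc j) → Der FJT Γ Δ (restricts j a w ⇔ restricts j b w)
≈ᶠ-elim j {a} {b} d w =
  cast (cong₂ _⇔_ (rename-restricts (sub₁ w) j (there a) here) (rename-restricts (sub₁ w) j (there b) here)) (∀E d w)

sameᶠ⇒≃ : ∀ {Γ Δ} (k : ℕ) {a b : Γ ∋ suc k} → Der FJT Γ Δ (sameᶠ k a b) →
           Der FJT Γ Δ (translate STT→FJT (sim k a b))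
sameᶠ⇒≃ k d = agree-elim k _ _ d k ≤′-refl

sameᶠ⇒≈ᶠ : ∀ {Γ Δ} (k : ℕ) {a b : Γ ∋ suc k} → Der FJT Γ Δ (sameᶠ k a b) → Der FJT Γ Δ (≈ᶠ k a b)
sameᶠ⇒≈ᶠ zero d = ⊤I
sameᶠ⇒≈ᶠ (suc j) {a} {b} d = ∀I (⇔I (transfer same) (transfer (agree-sym same)))
  where
    same : Der FJT _ _ (sameᶠ (suc j) (there a) (there b))
    same = cast (rename-agree there (suc j) _ _) (wkDer d)
    transfer : ∀ {c c′ Θ} → Der FJT (suc j ∷ _) Θ (sameᶠ (suc j) c c′) →
               Der FJT (suc j ∷ _) (restricts j c here ∷ Θ) (restricts j c′ here)
    transfer s = agree-trans (agree-lower (agree-sym (weakenHyp s))) hyp₀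

restricts-unique : ∀ {Γ Δ} (k : ℕ) {z : Γ ∋ suc (suc k)} {x y : Γ ∋ suc k} →
                   Der FJT Γ Δ (restricts k z x) → Der FJT Γ Δ (restricts k z y) → Der FJT Γ Δ (sameᶠ k x y)
restricts-unique k d e = agree-trans (agree-sym d) e

-- Below the top type, y's members are those of a restriction w of x (which y shares by ≈), hence those of z.
restricts-max : ∀ {Γ Δ} (k : ℕ) {z : Γ ∋ suc (suc k)} {x y : Γ ∋ suc k} →
                Der FJT Γ Δ (restricts k z x) → Der FJT Γ Δ (translate STT→FJT (sim k x y)) →
                Der FJT Γ Δ (≈ᶠ k y x) → Der FJT Γ Δ (restricts k z y)
restricts-max zero d s a = agree-intro zero _ _ λ { _ ≤′-refl → ∀⇔-trans (agree-elim zero _ _ d zero ≤′-refl) s }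
restricts-max {Γ} {Δ} (suc j) {z} {x} {y} d s a = agree-intro (suc j) _ _ clause
  where
    clause : ∀ t h → Der FJT Γ Δ (∀' t (lower (membersᶠ z) t h ⇔ membersᶠ y t h))
    clause _ ≤′-refl = ∀⇔-trans (agree-elim (suc j) _ _ d (suc j) ≤′-refl) s
    clause t (≤′-step h) = ∃E (restriction-exists j x) (∀⇔-trans z↾x (∀⇔-trans x↾w (∀⇔-sym y↾w)))
      where
        Δ′ : List (Formula FJSig (suc j ∷ Γ))
        Δ′ = restricts j (there x) here ∷ map wk Δ
        z↾x : Der FJT (suc j ∷ Γ) Δ′
                (∀' t (membersᶠ (there z) t (≤′-step (≤′-step h)) ⇔ membersᶠ (there x) t (≤′-step h)))
        z↾x = agree-elim (suc j) _ _ (cast (rename-restricts there (suc j) z x) (liftDer d)) t (≤′-step h)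
        x↾w : Der FJT (suc j ∷ Γ) Δ′ (∀' t (membersᶠ (there x) t (≤′-step h) ⇔ membersᶠ here t h))
        x↾w = agree-elim j _ _ hyp₀ t h
        y↾w : Der FJT (suc j ∷ Γ) Δ′ (∀' t (membersᶠ (there y) t (≤′-step h) ⇔ membersᶠ here t h))
        y↾w = agree-elim j _ _ (⇔E← (≈ᶠ-elim j (cast (rename-≈ᶠ there (suc j) y x) (liftDer a)) here) hyp₀) t h

STT→FJT-axiom : ∀ {Γ φ} → STTdown Γ φ → Der FJT Γ [] (translate STT→FJT φ)
STT→FJT-axiom (compSTT n φ) =
  cast (cong (λ χ → ∃' (suc n) (∀' n (applyᶠ n (there here) here ⇔ χ))) (sym (translate-rename STT→FJT (ext there) φ)))
    (comprehension-top n (translate STT→FJT φ))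
STT→FJT-axiom (comp₀ φ) =
  cast (cong (λ χ → ∃' 1 (∀' 0 (applyᶠ 0 (there here) here ⇔ χ))) (sym (translate-rename STT→FJT (ext there) φ)))
    (comprehension-top 0 (translate STT→FJT φ))
STT→FJT-axiom (ident n) = identityᶠ n
STT→FJT-axiom (compDown k φ) =
  cast (cong₂ (λ ζ χ → ∀' (suc k) (∃' (suc (suc k)) (ζ ∧ ∀' (suc k) (applyᶠ (suc k) (there here) here ⇔ χ))))
              (sym (translate-down k here (there here))) (sym (translate-rename STT→FJT (ext there) φ)))
    (comprehension↓ᶠ k (translate STT→FJT φ))
STT→FJT-axiom (downEx k) =
  cast (cong (λ ζ → ∀' (suc (suc k)) (∃' (suc k) ζ)) (sym (translate-down k (there here) here)))
    (∀I (restriction-exists k here))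
STT→FJT-axiom {Γ} (downSim k) = ∀I (∀I (∀I (⇒I (∧I (sameᶠ⇒≃ k same)
    (cast (sym (translate-approx k here (there here))) (sameᶠ⇒≈ᶠ k (agree-sym same)))))))
  where
    z⇝x∧z⇝y : Formula SSig (suc k ∷ suc k ∷ suc (suc k) ∷ Γ)
    z⇝x∧z⇝y = downS k (there (there here)) (there here) ∧ downS k (there (there here)) here
    same : Der FJT (suc k ∷ suc k ∷ suc (suc k) ∷ Γ) (translate STT→FJT z⇝x∧z⇝y ∷ []) (sameᶠ k (there here) here)
    same = restricts-unique k (cast (translate-down k _ _) (∧E₁ hyp₀)) (cast (translate-down k _ _) (∧E₂ hyp₀))
STT→FJT-axiom (downMax k) = ∀I (∀I (∀I (⇒I (cast (sym (translate-down k _ _))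
    (restricts-max k (cast (translate-down k _ _) (∧E₁ hyp₀)) (∧E₁ (∧E₂ hyp₀))
                     (cast (translate-approx k _ _) (∧E₂ (∧E₂ hyp₀))))))))

-- Round trips of atomic formulas

appᶠ⇔app↓ : ∀ {Γ Δ m k} (g : m ≤′ k) (b : Γ ∋ suc k) (a : Γ ∋ m) →
            Der FJT Γ Δ (appᶠ (≤′⇒<suc g) b a ⇔ translate STT→FJT (app↓ g b a))
appᶠ⇔app↓ ≤′-refl b a = ⇔-refl
appᶠ⇔app↓ (≤′-step {k} g) b a = ⇔I
  (∃-map (restriction-exists k b)
    (∧I (cast (sym (translate-down k (there b) here)) hyp₀)
        (⇔E→ (appᶠ⇔app↓ g here (there a)) (⇔E→ (restricts-app hyp₀ g (there a)) hyp₁))))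
  (∃E hyp₀ (⇔E← (restricts-app (cast (translate-down k (there b) here) (∧E₁ hyp₀)) g (there a))
                (⇔E← (appᶠ⇔app↓ g here (there a)) (∧E₂ hyp₀))))

FJT-atoms : ∀ Γ (r : Rel FJSig) (args : All (Γ ∋_) (arity FJSig r)) →
            Provable FJT Γ (rel r args ⇔ translate (compose FJT→STT STT→FJT) (rel r args))
FJT-atoms Γ (app (suc k) m (s≤s q)) (b ∷ a ∷ []) = Der⇒Provable (cast round-trip (appᶠ⇔app↓ (≤⇒≤′ q) b a))
  where
    round-trip : (appᶠ (≤′⇒<suc (≤⇒≤′ q)) b a ⇔ translate STT→FJT (app↓ (≤⇒≤′ q) b a))
               ≡ (appᶠ (s≤s q) b a
                  ⇔ rename (lookupArg (b ∷ a ∷ [])) (translate STT→FJT (app↓ (≤⇒≤′ q) here (there here))))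
    round-trip = cong₂ _⇔_ (appᶠ-irrelevant _ _ b a)
      (trans (cong (translate STT→FJT) (sym (rename-app↓ (lookupArg (b ∷ a ∷ [])) (≤⇒≤′ q) here (there here))))
             (translate-rename STT→FJT (lookupArg (b ∷ a ∷ [])) (app↓ (≤⇒≤′ q) here (there here))))

translate-membersᶠ : ∀ {Γ k} (z : Γ ∋ suc k) t h → translate FJT→STT (membersᶠ z t h) ≡ members↓ z t h
translate-membersᶠ z t h =
  trans (translate-FJT→STT-app (≤′⇒<suc h) (there z) here) (cong (λ g → app↓ g (there z) here) (≤′-irrelevant _ h))

translate-restricts : ∀ {Γ} (k : ℕ) (z : Γ ∋ suc (suc k)) (y : Γ ∋ suc k) →
                      translate FJT→STT (restricts k z y) ≡ sameExt↓ k z y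
translate-restricts k z y = trans (translate-agree FJT→STT k _ _)
  (agree-cong k (λ t h → translate-membersᶠ z t (≤′-step h)) (translate-membersᶠ y))

STT-atoms : ∀ Γ (r : Rel SSig) (args : All (Γ ∋_) (arity SSig r)) →
            Provable STTdown Γ (rel r args ⇔ translate (compose STT→FJT FJT→STT) (rel r args))
STT-atoms Γ (app n) (b ∷ a ∷ []) = Der⇒Provable (cast (cong (applyS n b a ⇔_) (sym round-trip)) ⇔-refl)
  where
    round-trip : rename (lookupArg (b ∷ a ∷ [])) (translate FJT→STT (applyᶠ n here (there here))) ≡ applyS n b a
    round-trip = trans (sym (translate-rename FJT→STT (lookupArg (b ∷ a ∷ [])) (applyᶠ n here (there here))))
      (trans (translate-FJT→STT-app (≤′⇒<suc ≤′-refl) b a)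
             (cong (λ g → app↓ g b a) (≤′-irrelevant _ ≤′-refl)))
STT-atoms Γ (down k) (z ∷ y ∷ []) = Der⇒Provable (cast (cong (downS k z y ⇔_) (sym round-trip)) (⇝⇔sameExt↓ k z y))
  where
    round-trip : rename (lookupArg (z ∷ y ∷ [])) (translate FJT→STT (restricts k here (there here))) ≡ sameExt↓ k z y
    round-trip = trans (sym (translate-rename FJT→STT (lookupArg (z ∷ y ∷ [])) (restricts k here (there here))))
      (trans (cong (translate FJT→STT) (rename-restricts (lookupArg (z ∷ y ∷ [])) k here (there here)))
             (translate-restricts k z y))

theoremD8 : DefinitionallyEquivalent STTdown FJT
theoremD8 =
  record { τ = STT→FJT ; sound = translate-provable STT→FJT STT→FJT-axiom } ,
  record { τ = FJT→STT ; sound = translate-provable FJT→STT FJT→STT-axiom } ,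
  (STT-atoms , λ Γ n x y → Der⇒Provable ⇔-refl) ,
  (FJT-atoms , λ Γ n x y → Der⇒Provable ⇔-refl)
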